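{- Let $Ag$ be a finite set of agents and $\mathcal{CS}$ a constant specification. Let $\Pi'(\mathcal{CS})$ be the axiomatic system obtained from $\Pi(\mathcal{CS})$ by removing the rule (S4) and adding the axiom scheme $$K(\neg Proven(t_1,B_1)\vee\dots\vee\neg Proven(t_n,B_n))\to\Big(\bigwedge_{j\in Ag}\neg Prove(j,t_1,B_1)\vee\dots\vee\bigwedge_{j\in Ag}\neg Prove(j,t_n,B_n)\Big)$$ for arbitrary $n\geq1$, $t_1,\dots,t_n\in Pol$, $B_1,\dots,B_n\in Form^{Ag}$. Then for every $A\in Form^{Ag}$, $A$ is provable in $\Pi(\mathcal{CS})$ iff $A$ is provable in $\Pi'(\mathcal{CS})$.
   Context: Language: finite $Ag$; countably infinite $PVar$, $PConst$, $Var$; $Pol$: $t ::= x\mid c\mid s+t\mid s\times t\mid\ !t$; $Form^{Ag}$: $A ::= p\mid A\wedge B\mid\neg A\mid[j]A\mid\Box A\mid t{:}A\mid KA\mid Prove(j,t,A)\mid Proven(t,A)$; $\Diamond$, $\langle j\rangle$ duals. Hilbert system $\Pi$: axiom schemes (A0) propositional tautologies; (A1) S5 axioms for $\Box$ and each $[j]$; (A2) $\Box A\to[j]A$; (A3) $(\Diamond[j_1]A_1\wedge\dots\wedge\Diamond[j_n]A_n)\to\Diamond([j_1]A_1\wedge\dots\wedge[j_n]A_n)$, $j_k$ pairwise distinct; (A4) $s{:}(A\to B)\to(t{:}A\to(s\times t){:}B)$; (A5) $t{:}A\to(!t{:}(t{:}A)\wedge KA)$; (A6) $(s{:}A\vee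 t{:}A)\to(s+t){:}A$; (A7) S4 axioms for $K$; (A8) $KA\to\Box K\Box A$; (B9) $Prove(j,t,A)\to(\neg Proven(t,A)\wedge[j]Prove(j,t,A)\wedge\neg\Box Prove(j,t,A)\wedge t{:}A)$; (B10) $(Prove(j,t,A)\wedge t{:}B)\to Prove(j,t,B)$; (B11) $Proven(t,A)\to(KProven(t,A)\wedge t{:}A)$; (B12) $(Proven(t,A)\wedge t{:}B)\to Proven(t,B)$; (B13) $\neg Prove(j,t,A)\to\langle j\rangle\bigwedge_{i\in Ag}\neg Prove(i,t,A)$. Rules: (R1) modus ponens; (R2) from $A$ infer $KA$; (S4) from $KA\to(\neg Proven(t_1,B_1)\vee\dots\vee\neg Proven(t_n,B_n))$ infer $KA\to(\bigwedge_{j\in Ag}\neg Prove(j,t_1,B_1)\vee\dots\vee\bigwedge_{j\in Ag}\neg Prove(j,t_n,B_n))$. A constant specification is a set $\mathcal{CS}$ of formulas $c_n{:}\dots c_1{:}A$ ($c_i\in PConst$, $A$ an instance of an axiom scheme above) such that $c_{n+1}{:}c_n{:}\dots c_1{:}A\in\mathcal{CS}$ implies $c_n{:}\dots c_1{:}A\in\mathcal{CS}$; $\Pi(\mathcal{CS})$ is $\Pi$ plus the rule "infer any $c_n{:}\dots c_1{:}A\in\mathcal{CS}$". -}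

module Defs where

open import Data.Nat using (ℕ)
open import Data.Fin using (Fin)
open import Data.Bool using (Bool; true; false; not; _∧_)
open import Data.List using (List; []; _∷_; map)
open import Data.List.NonEmpty using (List⁺; _∷_; toList)
open import Data.List.Relation.Unary.Unique.Propositional using (Unique)
open import Data.Product using (_×_; _,_; proj₁; proj₂)
open import Data.Fin using () renaming (zero to fz)
open import Data.List using (allFin)
open import Relation.Binary.PropositionalEquality using (_≡_)

-- Syntax.  PVar, PConst, Var are countably infinite: represented by ℕ.
-- The finite set of agents Ag is Fin m.

data Pol : Set where
  var   : ℕ → Pol
  const : ℕ → Pol
  _⊕_   : Pol → Pol → Pol
  _⊗_   : Pol → Pol → Pol
  !_    : Pol → Pol

data Form (m : ℕ) : Set where
  atom   : ℕ → Form m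
  _∧'_   : Form m → Form m → Form m
  ¬'_    : Form m → Form m
  [_]_   : Fin m → Form m → Form m
  □_     : Form m → Form m
  _∶_    : Pol → Form m → Form m
  K_     : Form m → Form m
  Prove  : Fin m → Pol → Form m → Form m
  Proven : Pol → Form m → Form m

infixr 30 _∧'_
infix 40 ¬'_ □_ K_ [_]_ _∶_

module _ {m : ℕ} where
  infixr 25 _∨'_
  infixr 20 _⇒_
  infix 40 ◇_ ⟨_⟩_

  _∨'_ : Form m → Form m → Form m
  A ∨' B = ¬' (¬' A ∧' ¬' B)

  _⇒_ : Form m → Form m → Form m
  A ⇒ B = ¬' (A ∧' ¬' B)

  ◇_ : Form m → Form m
  ◇ A = ¬' □ ¬' A

  ⟨_⟩_ : Fin m → Form m → Form m
  ⟨ j ⟩ A = ¬' [ j ] ¬' A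

  ⊤' : Form m
  ⊤' = ¬' (atom 0 ∧' ¬' atom 0)

  ⋀ : List (Form m) → Form m
  ⋀ []           = ⊤'
  ⋀ (A ∷ [])     = A
  ⋀ (A ∷ B ∷ As) = A ∧' ⋀ (B ∷ As)

  ⋁' : Form m → List (Form m) → Form m
  ⋁' A []       = A
  ⋁' A (B ∷ As) = A ∨' ⋁' B As

  ⋁⁺ : List⁺ (Form m) → Form m
  ⋁⁺ (A ∷ As) = ⋁' A As

  ⋀⁺ : List⁺ (Form m) → Form m
  ⋀⁺ (A ∷ As) = ⋀ (A ∷ As)

  ⋀Ag : (Fin m → Form m) → Form m
  ⋀Ag F = ⋀ (map F (allFin m))

  -- Propositional tautologies: formulas true under every Boolean
  -- valuation of their maximal non-(∧,¬) subformulas.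

  eval : (Form m → Bool) → Form m → Bool
  eval v (A ∧' B) = eval v A ∧ eval v B
  eval v (¬' A)   = not (eval v A)
  eval v A        = v A

  Tautology : Form m → Set
  Tautology A = ∀ (v : Form m → Bool) → eval v A ≡ true

  map⁺ : {X Y : Set} → (X → Y) → List⁺ X → List⁺ Y
  map⁺ f (x ∷ xs) = f x ∷ map f xs

  data Axiom : Form m → Set where
    A0   : ∀ {A} → Tautology A → Axiom A
    A1□K : ∀ A B → Axiom (□ (A ⇒ B) ⇒ (□ A ⇒ □ B))
    A1□T : ∀ A → Axiom (□ A ⇒ A)
    A1□5 : ∀ A → Axiom (◇ A ⇒ □ ◇ A)
    A1jK : ∀ j A B → Axiom ([ j ] (A ⇒ B) ⇒ ([ j ] A ⇒ [ j ] B))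
    A1jT : ∀ j A → Axiom ([ j ] A ⇒ A)
    A1j5 : ∀ j A → Axiom (⟨ j ⟩ A ⇒ [ j ] ⟨ j ⟩ A)
    A2   : ∀ j A → Axiom (□ A ⇒ [ j ] A)
    A3   : ∀ (ps : List⁺ (Fin m × Form m)) →
           Unique (map proj₁ (toList ps)) →
           Axiom (⋀⁺ (map⁺ (λ p → ◇ [ proj₁ p ] proj₂ p) ps)
                  ⇒ ◇ ⋀⁺ (map⁺ (λ p → [ proj₁ p ] proj₂ p) ps))
    A4   : ∀ s t A B → Axiom (s ∶ (A ⇒ B) ⇒ (t ∶ A ⇒ (s ⊗ t) ∶ B))
    A5   : ∀ t A → Axiom (t ∶ A ⇒ ((! t) ∶ (t ∶ A) ∧' K A))
    A6   : ∀ s t A → Axiom ((s ∶ A ∨' t ∶ A) ⇒ (s ⊕ t) ∶ A)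
    A7K  : ∀ A B → Axiom (K (A ⇒ B) ⇒ (K A ⇒ K B))
    A7T  : ∀ A → Axiom (K A ⇒ A)
    A74  : ∀ A → Axiom (K A ⇒ K K A)
    A8   : ∀ A → Axiom (K A ⇒ □ K □ A)
    B9   : ∀ j t A → Axiom (Prove j t A ⇒
             (¬' Proven t A ∧' [ j ] Prove j t A ∧' ¬' □ Prove j t A ∧' t ∶ A))
    B10  : ∀ j t A B → Axiom ((Prove j t A ∧' t ∶ B) ⇒ Prove j t B)
    B11  : ∀ t A → Axiom (Proven t A ⇒ (K Proven t A ∧' t ∶ A))
    B12  : ∀ t A B → Axiom ((Proven t A ∧' t ∶ B) ⇒ Proven t B)
    B13  : ∀ j t A → Axiom (¬' Prove j t A ⇒
             ⟨ j ⟩ ⋀Ag (λ i → ¬' Prove i t A))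

  data CSFormula : Form m → Set where
    base : ∀ c {A} → Axiom A → CSFormula (const c ∶ A)
    step : ∀ c {F} → CSFormula F → CSFormula (const c ∶ F)

  record IsConstSpec (CS : Form m → Set) : Set where
    field
      shape  : ∀ F → CS F → CSFormula F
      closed : ∀ c F → CSFormula F → CS (const c ∶ F) → CS F

  NotProvens : List⁺ (Pol × Form m) → Form m
  NotProvens ps = ⋁⁺ (map⁺ (λ p → ¬' Proven (proj₁ p) (proj₂ p)) ps)

  NoProves : List⁺ (Pol × Form m) → Form m
  NoProves ps = ⋁⁺ (map⁺ (λ p → ⋀Ag (λ j → ¬' Prove j (proj₁ p) (proj₂ p))) ps)

  data Π (CS : Form m → Set) : Form m → Set where
    ax  : ∀ {A} → Axiom A → Π CS A
    mp  : ∀ {A B} → Π CS (A ⇒ B) → Π CS A → Π CS B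
    nec : ∀ {A} → Π CS A → Π CS (K A)
    s4  : ∀ A ps → Π CS (K A ⇒ NotProvens ps) →
          Π CS (K A ⇒ NoProves ps)
    cs  : ∀ {F} → CS F → Π CS F

  data Π′ (CS : Form m → Set) : Form m → Set where
    ax  : ∀ {A} → Axiom A → Π′ CS A
    ax′ : ∀ ps → Π′ CS (K (NotProvens ps) ⇒ NoProves ps)
    mp  : ∀ {A B} → Π′ CS (A ⇒ B) → Π′ CS A → Π′ CS B
    nec : ∀ {A} → Π′ CS A → Π′ CS (K A)
    cs  : ∀ {F} → CS F → Π′ CS F

-- The two systems share every axiom and rule except one, so each derivation
-- is translated into the other system by structural recursion, keeping all
-- shared steps and re-deriving only the non-shared one:
--   * the new axiom K(¬Proven…) ⇒ ⋀¬Prove… is an instance of (S4) applied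
--     to K-reflexivity (A7T): K(NotProvens ps) ⇒ NotProvens ps;
--   * conversely, an application of (S4) to  ⊢ KA ⇒ NotProvens ps  is
--     simulated in Π′: necessitation and the K- and 4-axioms of K lift the
--     premise to  ⊢ KA ⇒ K(NotProvens ps), and chaining with the new axiom
--     yields  ⊢ KA ⇒ NoProves ps.
-- Hypothetical syllogism (a propositional tautology used via (A0) and modus
-- ponens) provides the chaining.  Neither translation uses the closure
-- properties of the constant specification, so both hold for every CS.
module Submission where

open import Defs
open import Data.Nat using (ℕ)
open import Data.Bool using (true; false)
open import Data.List.NonEmpty using (List⁺)
open import Data.Product using (_×_)
open import Function.Bundles using (_⇔_; mk⇔)
open import Relation.Binary.PropositionalEquality using (refl)

module _ {m : ℕ} {CS : Form m → Set} where

  syllogism-tautology : (X Y Z : Form m) →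
                        Tautology ((X ⇒ Y) ⇒ ((Y ⇒ Z) ⇒ (X ⇒ Z)))
  syllogism-tautology X Y Z v with eval v X | eval v Y | eval v Z
  ... | true  | true  | true  = refl
  ... | true  | true  | false = refl
  ... | true  | false | true  = refl
  ... | true  | false | false = refl
  ... | false | true  | true  = refl
  ... | false | true  | false = refl
  ... | false | false | true  = refl
  ... | false | false | false = refl

  chain′ : {X Y Z : Form m} → Π′ CS (X ⇒ Y) → Π′ CS (Y ⇒ Z) → Π′ CS (X ⇒ Z)
  chain′ {X} {Y} {Z} X⇒Y Y⇒Z =
    mp (mp (ax (A0 (syllogism-tautology X Y Z))) X⇒Y) Y⇒Z

  -- Derived rule of Π′: from ⊢ KA ⇒ B infer ⊢ KA ⇒ KB, since
  -- KA ⇒ KKA (axiom 4) and KKA ⇒ KB (necessitation and axiom K).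
  K-lift′ : {A B : Form m} → Π′ CS (K A ⇒ B) → Π′ CS (K A ⇒ K B)
  K-lift′ {A} {B} KA⇒B =
    chain′ (ax (A74 A)) (mp (ax (A7K (K A) B)) (nec KA⇒B))

  s4-admissible : (A : Form m) (ps : List⁺ (Pol × Form m)) →
                  Π′ CS (K A ⇒ NotProvens ps) → Π′ CS (K A ⇒ NoProves ps)
  s4-admissible A ps KA⇒NotProvens = chain′ (K-lift′ KA⇒NotProvens) (ax′ ps)

  new-axiom-derivable : (ps : List⁺ (Pol × Form m)) →
                        Π CS (K (NotProvens ps) ⇒ NoProves ps)
  new-axiom-derivable ps = s4 (NotProvens ps) ps (ax (A7T (NotProvens ps)))

  Π⇒Π′ : {A : Form m} → Π CS A → Π′ CS A
  Π⇒Π′ (ax a)         = ax a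
  Π⇒Π′ (mp p q)       = mp (Π⇒Π′ p) (Π⇒Π′ q)
  Π⇒Π′ (nec p)        = nec (Π⇒Π′ p)
  Π⇒Π′ (s4 A ps prem) = s4-admissible A ps (Π⇒Π′ prem)
  Π⇒Π′ (cs c)         = cs c

  Π′⇒Π : {A : Form m} → Π′ CS A → Π CS A
  Π′⇒Π (ax a)   = ax a
  Π′⇒Π (ax′ ps) = new-axiom-derivable ps
  Π′⇒Π (mp p q) = mp (Π′⇒Π p) (Π′⇒Π q)
  Π′⇒Π (nec p)  = nec (Π′⇒Π p)
  Π′⇒Π (cs c)   = cs c

lemma4 : (m : ℕ) (CS : Form m → Set) → IsConstSpec CS →
    (A : Form m) → Π CS A ⇔ Π′ CS A
lemma4 m CS _ A = mk⇔ Π⇒Π′ Π′⇒Π
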